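{- For $p\in\mathbb{N}_0$ and all $n\in\mathbb{N}$, \begin{align*} \sum_{m=1}^nm^pH_{m-1}H_{m-1}(2)=&H_n(-p)H_nH_n(2)-\frac{B_p}{2}H_n^2+\Big(D^{(p)}(B)-C^{(p)}_1(n)-\frac p2B_{p-1}\Big)H_n\\ &-\Big(C^{(p)}_0(n)+\frac{B_p}{2}\Big)H_n(2)+C^{(p)}_{0,1}(n)+C^{(p)}_{1,1}(n)-C^{(p)}_2(n). \end{align*}
   Context: $H_m(k)=\sum_{j=1}^mj^{ -k}$, $H_m=H_m(1)$ (empty sums $=0$), and $H_n(-p)=\sum_{m=1}^nm^p$. Bernoulli numbers: $\frac{te^t}{e^t-1}=\sum_{j\ge0}B_j\frac{t^j}{j!}$; the term $\frac p2B_{p-1}$ is $0$ when $p=0$. For $p\in\mathbb{N}_0$, $r\ge1$, $a_2,\dots,a_r\in\mathbb{N}_0$ and $a_1=0$, $$C^{(p)}_{a_2,\dots,a_r}(x)=\sum_{\substack{j_1,\dots,j_r\ge0\\ j_1+\dots+j_r\le p-a_r}}\Big(\prod_{i=1}^r\frac{\binom{p+1-a_i-j_1-\dots-j_{i-1}}{j_i}B_{j_i}}{p+1-a_i-j_1-\dots-j_{i-1}}\Big)x^{p+1-a_r-j_1-\dots-j_r}$$ (empty sum $=0$); for $r=1$ this is $C^{(p)}(x)=\sum_{j=0}^p\binom{p+1}{j}\frac{B_j}{p+1}x^{p+1-j}$. Since all exponents of $x$ are $\ge1$, $D^{(p)}_{a_2,\dots,a_r}(x):=C^{(p)}_{a_2,\dots,a_r}(x)/x$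 is a polynomial; $D^{(p)}(B)$ denotes the number obtained from the polynomial $D^{(p)}(x)$ by replacing each $x^i$ with $B_i$ (umbral convention). -}

module Defs where

open import Data.Nat as ℕ using (ℕ; zero; suc; _∸_; _≤?_)
open import Data.Nat.Combinatorics using (_C_)
open import Data.Integer as ℤ using (+_)
open import Data.Rational using (ℚ; 0ℚ; 1ℚ; _+_; _*_; _-_; _/_)
open import Data.List using (List; []; _∷_; _++_; [_]; foldr; length)
open import Relation.Nullary using (yes; no)

⟦_⟧ : ℕ → ℚ
⟦ n ⟧ = (+ n) / 1

_^ℚ_ : ℚ → ℕ → ℚ
x ^ℚ zero = 1ℚ
x ^ℚ suc k = x * (x ^ℚ k)

Σ0 : ℕ → (ℕ → ℚ) → ℚ
Σ0 zero f = f 0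
Σ0 (suc n) f = Σ0 n f + f (suc n)

Σ1 : ℕ → (ℕ → ℚ) → ℚ
Σ1 zero f = 0ℚ
Σ1 (suc n) f = Σ1 n f + f (suc n)

-- Bernoulli numbers with B₁ = +1/2  (t e^t/(e^t-1) = Σ B_j t^j/j!),
-- characterised by  Σ_{k=0}^{m} (m+1 choose k) B_k = m+1.
-- bernList n = [B₀, …, B_{n-1}]
private
  index : List ℚ → ℕ → ℚ
  index [] _ = 0ℚ
  index (x ∷ xs) zero = x
  index (x ∷ xs) (suc k) = index xs k

  sumIdx : (ℕ → ℚ) → ℕ → ℚ
  sumIdx f zero = 0ℚ
  sumIdx f (suc n) = sumIdx f n + f n

bernList : ℕ → List ℚ
bernList zero = []
bernList (suc m) =
  let bs = bernList m
  in bs ++ [ (⟦ suc m ⟧ - sumIdx (λ k → ⟦ suc m C k ⟧ * index bs k) m) * ((+ 1) / suc m) ]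

B : ℕ → ℚ
B n = index (bernList (suc n)) n

-- 1/n for n ≥ 1 (value at 0 is irrelevant; set to 0)
inv : ℕ → ℚ
inv zero = 0ℚ
inv (suc k) = (+ 1) / suc k

H : ℕ → ℚ
H m = Σ1 m inv

H2 : ℕ → ℚ
H2 m = Σ1 m (λ j → inv (j ℕ.* j))

Hneg : ℕ → ℕ → ℚ
Hneg p n = Σ1 n (λ m → ⟦ m ⟧ ^ℚ p)

-- The nested sum defining C^{(p)}_{a_2,…,a_r}, with the monomial x^{p+1-a_r-j_1-…-j_r}
-- abstracted as  mon (p - a_r - j_1 - … - j_r)  (so that C uses mon e = x^{e+1},
-- D(x) = C(x)/x uses x^e, and the umbral D(B) uses B_e).
-- s = j_1 + … + j_{i-1} so far; each j_i ranges over 0 … (p - a_r - s)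
-- (all later j's are ≥ 0, so this is exactly the constraint Σ j ≤ p - a_r).
private
  last : ℕ → List ℕ → ℕ
  last a [] = a
  last _ (b ∷ bs) = last b bs

  go : (p aR : ℕ) → (ℕ → ℚ) → List ℕ → ℕ → ℚ
  go p aR mon [] s = mon (p ∸ aR ∸ s)
  go p aR mon (a ∷ as) s =
    Σ0 (p ∸ aR ∸ s) (λ j →
      inv (suc p ∸ a ∸ s) * ⟦ (suc p ∸ a ∸ s) C j ⟧ * B j * go p aR mon as (s ℕ.+ j))

-- Cgen p [a_2,…,a_r] mon : the sum with a_1 = 0 prepended; empty (= 0) if a_r > p.
Cgen : ℕ → List ℕ → (ℕ → ℚ) → ℚ
Cgen p as mon with last 0 as ≤? p
... | yes _ = go p (last 0 as) mon (0 ∷ as) 0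
... | no _ = 0ℚ

Cp : ℕ → List ℕ → ℚ → ℚ
Cp p as x = Cgen p as (λ e → x ^ℚ suc e)

-- D^{(p)}(B) : D^{(p)}(x) = C^{(p)}(x)/x with x^i replaced by B_i
DpB : ℕ → ℚ
DpB p = Cgen p [] B

-- Each C^{(p)}_{a₂,…,a_r}(x) is a nested sum whose innermost sum, taken against x^{e+1}, is
-- Bernoulli's formula for a sum of powers. Hence the forward difference Δf(x) = f(x+1) − f(x)
-- only removes the innermost level, and with Y = x+1:
--   ΔC = Y^p,  Y ΔC₀ = C,  Y² ΔC₁ = C − B_p Y,  Y³ ΔC₂ = C − (p/2) B_{p−1} Y² − B_p Y,
--   Y² ΔC_{0,1} = C₀ − D^{(p)}(B) Y,  Y ΔC_{1,1} = C₁,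
-- the boundary terms coming from the top indices the shorter sums lack. In particular
-- C(n) = H_n(−p), and together with H_{n+1} = H_n + 1/(n+1), H_{n+1}(2) = H_n(2) + 1/(n+1)²
-- the theorem follows by induction on n, the step being a polynomial identity.

module Submission where

open import Defs
open import Level using (0ℓ)
open import Data.Nat as ℕ using (ℕ; zero; suc; _∸_; _≤_; _<_; z≤n; s≤s; _!)
import Data.Nat.Properties as ℕₚ
open import Data.Nat.DivMod using (m/n*n≡m)
open import Data.Nat.Combinatorics
  using (_C_; nCk+nC[k+1]≡[n+1]C[k+1]; k>n⇒nCk≡0; nC1≡n; nCk≡nC[n∸k]; nCn≡1; nCk≡n!/k![n-k]!; k![n∸k]!∣n!)
import Data.Nat.Tactic.RingSolver as ℕ-Solver
open import Data.Nat.Coprimality using (1-coprimeTo) renaming (sym to coprime-sym)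
open import Data.Integer as ℤ using (+_)
import Data.Integer.Properties as ℤₚ
open import Data.Rational using (ℚ; 0ℚ; 1ℚ; _+_; _*_; _-_; _/_; mkℚ; _≟_)
import Data.Rational.Properties as ℚₚ
open import Data.List using (List; []; _∷_; _++_; [_]; length)
import Data.List.Properties as Listₚ
open import Data.Sum using (inj₁; inj₂)
open import Relation.Binary.PropositionalEquality
  using (_≡_; refl; sym; trans; cong; cong₂; subst; subst₂; module ≡-Reasoning)
open import Relation.Nullary using (dec⇒maybe)
open import Tactic.RingSolver.Core.AlmostCommutativeRing using (AlmostCommutativeRing; fromCommutativeRing)
open import Tactic.RingSolver using (solve-∀)

open ≡-Reasoning

ℚ-ring : AlmostCommutativeRing 0ℓ 0ℓ
ℚ-ring = fromCommutativeRing ℚₚ.+-*-commutativeRing (λ x → dec⇒maybe (0ℚ ≟ x))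

½ : ℚ
½ = (+ 1) / 2

⟦⟧≡mkℚ : ∀ n → ⟦ n ⟧ ≡ mkℚ (+ n) 0 (coprime-sym (1-coprimeTo n))
⟦⟧≡mkℚ n = ℚₚ.normalize-coprime (coprime-sym (1-coprimeTo n))

⟦⟧-homo-+ : ∀ m n → ⟦ m ℕ.+ n ⟧ ≡ ⟦ m ⟧ + ⟦ n ⟧
⟦⟧-homo-+ m n = sym (trans (cong₂ _+_ (⟦⟧≡mkℚ m) (⟦⟧≡mkℚ n))
  (ℚₚ./-cong (cong₂ ℤ._+_ (ℤₚ.*-identityʳ (+ m)) (ℤₚ.*-identityʳ (+ n))) refl))

⟦⟧-homo-* : ∀ m n → ⟦ m ℕ.* n ⟧ ≡ ⟦ m ⟧ * ⟦ n ⟧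
⟦⟧-homo-* m n = sym (trans (cong₂ _*_ (⟦⟧≡mkℚ m) (⟦⟧≡mkℚ n)) (ℚₚ./-cong (sym (ℤₚ.pos-* m n)) refl))

⟦⟧-suc : ∀ n → ⟦ suc n ⟧ ≡ ⟦ n ⟧ + 1ℚ
⟦⟧-suc n = trans (cong ⟦_⟧ (ℕₚ.+-comm 1 n)) (⟦⟧-homo-+ n 1)

inv-inverseˡ : ∀ k → inv (suc k) * ⟦ suc k ⟧ ≡ 1ℚ
inv-inverseˡ k = trans (cong₂ _*_ (ℚₚ.normalize-coprime (1-coprimeTo (suc k))) (⟦⟧≡mkℚ (suc k)))
  (ℚₚ.*-inverseˡ (mkℚ (+ suc k) 0 (coprime-sym (1-coprimeTo (suc k)))))

inv-inverseʳ : ∀ k → ⟦ suc k ⟧ * inv (suc k) ≡ 1ℚ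
inv-inverseʳ k = trans (ℚₚ.*-comm ⟦ suc k ⟧ (inv (suc k))) (inv-inverseˡ k)

inv-square : ∀ k → inv (suc k ℕ.* suc k) ≡ inv (suc k) * inv (suc k)
inv-square k = begin
  a                                    ≡⟨ multiply-by-one a ⟩
  a * 1ℚ * 1ℚ                          ≡⟨ cong (λ u → a * u * u) (sym (inv-inverseʳ k)) ⟩
  a * (y * b) * (y * b)                ≡⟨ regroup a b y ⟩
  (a * (y * y)) * (b * b)              ≡⟨ cong (λ v → (a * v) * (b * b)) (sym (⟦⟧-homo-* (suc k) (suc k))) ⟩
  (a * ⟦ suc k ℕ.* suc k ⟧) * (b * b)  ≡⟨ cong (_* (b * b)) (inv-inverseˡ (k ℕ.+ k ℕ.* suc k)) ⟩
  1ℚ * (b * b)                         ≡⟨ ℚₚ.*-identityˡ (b * b) ⟩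
  b * b                                ∎
  where
  a = inv (suc k ℕ.* suc k)
  b = inv (suc k)
  y = ⟦ suc k ⟧
  multiply-by-one : ∀ (a : ℚ) → a ≡ a * 1ℚ * 1ℚ
  multiply-by-one = solve-∀ ℚ-ring
  regroup : ∀ (a b y : ℚ) → a * (y * b) * (y * b) ≡ (a * (y * y)) * (b * b)
  regroup = solve-∀ ℚ-ring

Σ0-cong : ∀ q {f g : ℕ → ℚ} → (∀ j → j ≤ q → f j ≡ g j) → Σ0 q f ≡ Σ0 q g
Σ0-cong zero    f≡g = f≡g 0 z≤n
Σ0-cong (suc q) f≡g = cong₂ _+_ (Σ0-cong q (λ j j≤q → f≡g j (ℕₚ.m≤n⇒m≤1+n j≤q))) (f≡g (suc q) ℕₚ.≤-refl)

Σ0-+ : ∀ q (f g : ℕ → ℚ) → Σ0 q (λ j → f j + g j) ≡ Σ0 q f + Σ0 q g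
Σ0-+ zero    f g = refl
Σ0-+ (suc q) f g =
  trans (cong (_+ (f (suc q) + g (suc q))) (Σ0-+ q f g)) (interchange (Σ0 q f) (Σ0 q g) (f (suc q)) (g (suc q)))
  where
  interchange : ∀ (a b c d : ℚ) → a + b + (c + d) ≡ a + c + (b + d)
  interchange = solve-∀ ℚ-ring

Σ0-minus : ∀ q (f g : ℕ → ℚ) → Σ0 q (λ j → f j - g j) ≡ Σ0 q f - Σ0 q g
Σ0-minus zero    f g = refl
Σ0-minus (suc q) f g =
  trans (cong (_+ (f (suc q) - g (suc q))) (Σ0-minus q f g)) (interchange (Σ0 q f) (Σ0 q g) (f (suc q)) (g (suc q)))
  where
  interchange : ∀ (a b c d : ℚ) → a - b + (c - d) ≡ a + c - (b + d)
  interchange = solve-∀ ℚ-ring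

Σ0-*ˡ : ∀ q (a : ℚ) (f : ℕ → ℚ) → Σ0 q (λ j → a * f j) ≡ a * Σ0 q f
Σ0-*ˡ zero    a f = refl
Σ0-*ˡ (suc q) a f = trans (cong (_+ (a * f (suc q))) (Σ0-*ˡ q a f)) (sym (ℚₚ.*-distribˡ-+ a (Σ0 q f) (f (suc q))))

Σ0-*ʳ : ∀ q (a : ℚ) (f : ℕ → ℚ) → Σ0 q (λ j → f j * a) ≡ Σ0 q f * a
Σ0-*ʳ q a f = trans (Σ0-cong q (λ j _ → ℚₚ.*-comm (f j) a)) (trans (Σ0-*ˡ q a f) (ℚₚ.*-comm a (Σ0 q f)))

Σ0-zero : ∀ q (f : ℕ → ℚ) → (∀ j → f j ≡ 0ℚ) → Σ0 q f ≡ 0ℚ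
Σ0-zero zero    f f≡0 = f≡0 0
Σ0-zero (suc q) f f≡0 = cong₂ _+_ (Σ0-zero q f f≡0) (f≡0 (suc q))

Σ0-suc-head : ∀ q (f : ℕ → ℚ) → Σ0 (suc q) f ≡ f 0 + Σ0 q (λ j → f (suc j))
Σ0-suc-head zero    f = refl
Σ0-suc-head (suc q) f =
  trans (cong (_+ f (suc (suc q))) (Σ0-suc-head q f)) (ℚₚ.+-assoc (f 0) (Σ0 q (λ j → f (suc j))) (f (suc (suc q))))

suc-∸ : ∀ {q j} → j ≤ q → suc q ∸ j ≡ suc (q ∸ j)
suc-∸ = ℕₚ.+-∸-assoc 1

Σ0-triangle-swap : ∀ q (f : ℕ → ℕ → ℚ) →
  Σ0 q (λ j → Σ0 (q ∸ j) (λ i → f j i)) ≡ Σ0 q (λ i → Σ0 (q ∸ i) (λ j → f j i))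
Σ0-triangle-swap zero    f = refl
Σ0-triangle-swap (suc q) f = begin
  Σ0 (suc q) (λ j → Σ0 (suc q ∸ j) (λ i → f j i))
    ≡⟨ Σ0-suc-head q (λ j → Σ0 (suc q ∸ j) (λ i → f j i)) ⟩
  Σ0 (suc q) (f 0) + Σ0 q (λ j → Σ0 (q ∸ j) (λ i → f (suc j) i))
    ≡⟨ cong (λ u → Σ0 (suc q) (f 0) + u) (Σ0-triangle-swap q (λ j → f (suc j))) ⟩
  (Σ0 q (f 0) + f 0 (suc q)) + Σ0 q (λ i → rest i)
    ≡⟨ swap-last (Σ0 q (f 0)) (f 0 (suc q)) (Σ0 q (λ i → rest i)) ⟩
  (Σ0 q (f 0) + Σ0 q (λ i → rest i)) + f 0 (suc q)
    ≡⟨ cong (_+ f 0 (suc q)) (sym (Σ0-+ q (f 0) rest)) ⟩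
  Σ0 q (λ i → f 0 i + rest i) + f 0 (suc q)
    ≡⟨ cong₂ _+_ (Σ0-cong q (λ i i≤q → trans (sym (Σ0-suc-head (q ∸ i) (λ j → f j i)))
                                              (cong (λ n → Σ0 n (λ j → f j i)) (sym (suc-∸ i≤q)))))
                 (cong (λ n → Σ0 n (λ j → f j (suc q))) (sym (ℕₚ.n∸n≡0 q))) ⟩
  Σ0 q (λ i → Σ0 (suc q ∸ i) (λ j → f j i)) + Σ0 (suc q ∸ suc q) (λ j → f j (suc q)) ∎
  where
  rest : ℕ → ℚ
  rest i = Σ0 (q ∸ i) (λ j → f (suc j) i)
  swap-last : ∀ (a b c : ℚ) → a + b + c ≡ a + c + b
  swap-last = solve-∀ ℚ-ring

nCk*k![n∸k]!≡n! : ∀ {n k} → k ≤ n → (n C k) ℕ.* (k ! ℕ.* (n ∸ k) !) ≡ n !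
nCk*k![n∸k]!≡n! {n} {k} k≤n = trans (cong (ℕ._* (k ! ℕ.* (n ∸ k) !)) (nCk≡n!/k![n-k]! k≤n))
                                    (m/n*n≡m {{k ℕₚ.!* (n ∸ k) !≢0}} (k![n∸k]!∣n! k≤n))

nCj*[n∸j]Ci≡nCi*[n∸i]Cj : ∀ n i j → i ℕ.+ j ≤ n → (n C j) ℕ.* ((n ∸ j) C i) ≡ (n C i) ℕ.* ((n ∸ i) C j)
nCj*[n∸j]Ci≡nCi*[n∸i]Cj n i j i+j≤n =
  ℕₚ.*-cancelʳ-≡ _ _ (j ! ℕ.* (i ! ℕ.* r !)) {{ℕₚ.m*n≢0 (j !) _ {{j ℕₚ.!≢0}} {{i ℕₚ.!* r !≢0}}}}
    (trans via-j (sym via-i))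
  where
  r = n ∸ j ∸ i
  r≡n∸i∸j : n ∸ i ∸ j ≡ r
  r≡n∸i∸j = trans (ℕₚ.∸-+-assoc n i j) (trans (cong (n ∸_) (ℕₚ.+-comm i j)) (sym (ℕₚ.∸-+-assoc n j i)))
  regroupʲ : ∀ (a b c d e : ℕ) → a ℕ.* b ℕ.* (c ℕ.* (d ℕ.* e)) ≡ a ℕ.* (c ℕ.* (b ℕ.* (d ℕ.* e)))
  regroupʲ = ℕ-Solver.solve-∀
  regroupⁱ : ∀ (a b c d e : ℕ) → a ℕ.* b ℕ.* (c ℕ.* (d ℕ.* e)) ≡ a ℕ.* (d ℕ.* (b ℕ.* (c ℕ.* e)))
  regroupⁱ = ℕ-Solver.solve-∀
  via-j : (n C j) ℕ.* ((n ∸ j) C i) ℕ.* (j ! ℕ.* (i ! ℕ.* r !)) ≡ n !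
  via-j = trans (regroupʲ (n C j) ((n ∸ j) C i) (j !) (i !) (r !))
        (trans (cong (λ u → (n C j) ℕ.* (j ! ℕ.* u)) (nCk*k![n∸k]!≡n! (ℕₚ.m+n≤o⇒m≤o∸n i i+j≤n)))
               (nCk*k![n∸k]!≡n! (ℕₚ.m+n≤o⇒n≤o i i+j≤n)))
  via-i : (n C i) ℕ.* ((n ∸ i) C j) ℕ.* (j ! ℕ.* (i ! ℕ.* r !)) ≡ n !
  via-i = trans (regroupⁱ (n C i) ((n ∸ i) C j) (j !) (i !) (r !))
        (trans (cong (λ u → (n C i) ℕ.* (i ! ℕ.* (((n ∸ i) C j) ℕ.* (j ! ℕ.* u)))) (cong _! (sym r≡n∸i∸j)))
        (trans (cong (λ u → (n C i) ℕ.* (i ! ℕ.* u))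
                     (nCk*k![n∸k]!≡n! (ℕₚ.m+n≤o⇒m≤o∸n j (subst (_≤ n) (ℕₚ.+-comm i j) i+j≤n))))
               (nCk*k![n∸k]!≡n! (ℕₚ.m+n≤o⇒m≤o i i+j≤n))))

[1+q]Ci*[1+q∸i]≡[1+q]*qCi : ∀ q i → i ≤ q → (suc q C i) ℕ.* suc (q ∸ i) ≡ suc q ℕ.* (q C i)
[1+q]Ci*[1+q∸i]≡[1+q]*qCi q i i≤q =
  ℕₚ.*-cancelʳ-≡ _ _ (i ! ℕ.* (q ∸ i) !) {{i ℕₚ.!* (q ∸ i) !≢0}} (trans lhs (sym rhs))
  where
  regroup : ∀ (a b c d : ℕ) → a ℕ.* b ℕ.* (c ℕ.* d) ≡ a ℕ.* (c ℕ.* (b ℕ.* d))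
  regroup = ℕ-Solver.solve-∀
  lhs : (suc q C i) ℕ.* suc (q ∸ i) ℕ.* (i ! ℕ.* (q ∸ i) !) ≡ suc q !
  lhs = trans (regroup (suc q C i) (suc (q ∸ i)) (i !) ((q ∸ i) !))
        (trans (cong (λ u → (suc q C i) ℕ.* (i ! ℕ.* (u !))) (sym (suc-∸ i≤q)))
               (nCk*k![n∸k]!≡n! (ℕₚ.m≤n⇒m≤1+n i≤q)))
  rhs : suc q ℕ.* (q C i) ℕ.* (i ! ℕ.* (q ∸ i) !) ≡ suc q !
  rhs = trans (ℕₚ.*-assoc (suc q) (q C i) (i ! ℕ.* (q ∸ i) !)) (cong (suc q ℕ.*_) (nCk*k![n∸k]!≡n! i≤q))

2*[3+k]C[1+k]≡[3+k]*[2+k] : ∀ k → 2 ℕ.* ((3 ℕ.+ k) C suc k) ≡ (3 ℕ.+ k) ℕ.* (2 ℕ.+ k)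
2*[3+k]C[1+k]≡[3+k]*[2+k] k = ℕₚ.*-cancelʳ-≡ _ _ (suc k !) {{suc k ℕₚ.!≢0}} (trans lhs (sym rhs))
  where
  n = 3 ℕ.+ k
  regroup : ∀ (a b : ℕ) → 2 ℕ.* a ℕ.* b ≡ a ℕ.* (b ℕ.* 2)
  regroup = ℕ-Solver.solve-∀
  lhs : 2 ℕ.* (n C suc k) ℕ.* suc k ! ≡ n !
  lhs = trans (regroup (n C suc k) (suc k !))
        (trans (cong (λ u → (n C suc k) ℕ.* (suc k ! ℕ.* (u !))) (sym (ℕₚ.m+n∸n≡m 2 (suc k))))
               (nCk*k![n∸k]!≡n! (ℕₚ.m≤n⇒m≤1+n (ℕₚ.n≤1+n (suc k)))))
  rhs : n ℕ.* (2 ℕ.+ k) ℕ.* suc k ! ≡ n !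
  rhs = ℕₚ.*-assoc n (2 ℕ.+ k) (suc k !)

[1+m]Cm≡1+m : ∀ m → suc m C m ≡ suc m
[1+m]Cm≡1+m m = trans (nCk≡nC[n∸k] (ℕₚ.n≤1+n m)) (trans (cong (suc m C_) (ℕₚ.m+n∸n≡m 1 m)) (nC1≡n (suc m)))

-- The list lookup and partial sum used by `bernList` are private to Defs; they are
-- recovered as solutions of unification problems, made higher-order patterns by `with`.
mutual
  lookupℚ : List ℚ → ℕ → ℚ
  lookupℚ = _

  B≡lookup : ∀ m → B m ≡ lookupℚ (bernList (suc m)) m
  B≡lookup m with bernList (suc m)
  ... | _ = refl

mutual
  Σ< : (ℕ → ℚ) → ℕ → ℚ
  Σ< = _

  bernList-suc : ∀ m → bernList (suc m) ≡
    bernList m ++ [ (⟦ suc m ⟧ - Σ< (λ k → ⟦ suc m C k ⟧ * lookupℚ (bernList m) k) m) * inv (suc m) ]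
  bernList-suc m with (λ k → ⟦ suc m C k ⟧ * lookupℚ (bernList m) k)
  ... | _ = refl

length-bernList : ∀ m → length (bernList m) ≡ m
length-bernList zero    = refl
length-bernList (suc m) = begin
  length (bernList (suc m))        ≡⟨ cong length (bernList-suc m) ⟩
  length (bernList m ++ [ _ ])     ≡⟨ Listₚ.length-++ (bernList m) ⟩
  length (bernList m) ℕ.+ 1        ≡⟨ cong (ℕ._+ 1) (length-bernList m) ⟩
  m ℕ.+ 1                          ≡⟨ ℕₚ.+-comm m 1 ⟩
  suc m                            ∎

lookupℚ-++ˡ : ∀ xs ys k → k < length xs → lookupℚ (xs ++ ys) k ≡ lookupℚ xs k
lookupℚ-++ˡ (x ∷ xs) ys zero    _         = refl
lookupℚ-++ˡ (x ∷ xs) ys (suc k) (s≤s k<n) = lookupℚ-++ˡ xs ys k k<n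

lookupℚ-last : ∀ xs y → lookupℚ (xs ++ [ y ]) (length xs) ≡ y
lookupℚ-last []       y = refl
lookupℚ-last (x ∷ xs) y = lookupℚ-last xs y

lookup-bernList : ∀ m k → k < m → lookupℚ (bernList m) k ≡ B k
lookup-bernList (suc m) k k<1+m with ℕₚ.m<1+n⇒m<n∨m≡n k<1+m
... | inj₂ refl = sym (B≡lookup k)
... | inj₁ k<m  = begin
  lookupℚ (bernList (suc m)) k         ≡⟨ cong (λ l → lookupℚ l k) (bernList-suc m) ⟩
  lookupℚ (bernList m ++ [ _ ]) k      ≡⟨ lookupℚ-++ˡ (bernList m) _ k (subst (k <_) (sym (length-bernList m)) k<m) ⟩
  lookupℚ (bernList m) k               ≡⟨ lookup-bernList m k k<m ⟩
  B k                                  ∎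

Σ<-suc : ∀ f n → Σ< f (suc n) ≡ Σ0 n f
Σ<-suc f zero    = ℚₚ.+-identityˡ (f 0)
Σ<-suc f (suc n) = cong (_+ f (suc n)) (Σ<-suc f n)

Σ<-cong : ∀ n {f g} → (∀ k → k < n → f k ≡ g k) → Σ< f n ≡ Σ< g n
Σ<-cong zero    f≡g = refl
Σ<-cong (suc n) f≡g = cong₂ _+_ (Σ<-cong n (λ k k<n → f≡g k (ℕₚ.m<n⇒m<1+n k<n))) (f≡g n ℕₚ.≤-refl)

bernoulli-recurrence : ∀ m → Σ0 m (λ k → ⟦ suc m C k ⟧ * B k) ≡ ⟦ suc m ⟧
bernoulli-recurrence m = begin
  Σ0 m g                        ≡⟨ sym (Σ<-suc g m) ⟩
  Σ< g m + g m                  ≡⟨ cong₂ _+_ (Σ<-cong m (λ k k<m → cong (⟦ suc m C k ⟧ *_) (sym (lookup-bernList m k k<m))))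
                                             (cong₂ _*_ (cong ⟦_⟧ ([1+m]Cm≡1+m m)) B-top) ⟩
  S + y * ((y - S) * inv (suc m)) ≡⟨ regroup S y (inv (suc m)) ⟩
  S + (y - S) * (y * inv (suc m)) ≡⟨ cong (λ u → S + (y - S) * u) (inv-inverseʳ m) ⟩
  S + (y - S) * 1ℚ              ≡⟨ cancel S y ⟩
  y                             ∎
  where
  g = λ k → ⟦ suc m C k ⟧ * B k
  y = ⟦ suc m ⟧
  S = Σ< (λ k → ⟦ suc m C k ⟧ * lookupℚ (bernList m) k) m
  B-top : B m ≡ (y - S) * inv (suc m)
  B-top = trans (B≡lookup m) (trans (cong (λ l → lookupℚ l m) (bernList-suc m))
            (subst (λ n → lookupℚ (bernList m ++ [ (y - S) * inv (suc m) ]) n ≡ (y - S) * inv (suc m))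
                   (length-bernList m) (lookupℚ-last (bernList m) _)))
  regroup : ∀ (a b c : ℚ) → a + b * ((b - a) * c) ≡ a + (b - a) * (b * c)
  regroup = solve-∀ ℚ-ring
  cancel : ∀ (a b : ℚ) → a + (b - a) * 1ℚ ≡ b
  cancel = solve-∀ ℚ-ring

binomial-theorem : ∀ (x : ℚ) m → (x + 1ℚ) ^ℚ m ≡ Σ0 m (λ i → ⟦ m C i ⟧ * x ^ℚ i)
binomial-theorem x zero    = refl
binomial-theorem x (suc m) = begin
  (x + 1ℚ) * (x + 1ℚ) ^ℚ m
    ≡⟨ cong ((x + 1ℚ) *_) (binomial-theorem x m) ⟩
  (x + 1ℚ) * Σ0 m f
    ≡⟨ distrib x (Σ0 m f) ⟩
  x * Σ0 m f + Σ0 m f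
    ≡⟨ cong₂ _+_ (trans (sym (Σ0-*ˡ m x f)) (Σ0-cong m (λ i _ → comm-left x ⟦ m C i ⟧ (x ^ℚ i)))) low-terms ⟩
  Σ0 m (λ i → ⟦ m C i ⟧ * x ^ℚ suc i) + (1ℚ + Σ0 m (λ i → ⟦ m C suc i ⟧ * x ^ℚ suc i))
    ≡⟨ swap-one (Σ0 m (λ i → ⟦ m C i ⟧ * x ^ℚ suc i)) (Σ0 m (λ i → ⟦ m C suc i ⟧ * x ^ℚ suc i)) ⟩
  1ℚ + (Σ0 m (λ i → ⟦ m C i ⟧ * x ^ℚ suc i) + Σ0 m (λ i → ⟦ m C suc i ⟧ * x ^ℚ suc i))
    ≡⟨ cong (λ u → 1ℚ + u) (sym (Σ0-+ m _ _)) ⟩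
  1ℚ + Σ0 m (λ i → ⟦ m C i ⟧ * x ^ℚ suc i + ⟦ m C suc i ⟧ * x ^ℚ suc i)
    ≡⟨ cong₂ _+_ (sym (ℚₚ.*-identityʳ 1ℚ)) (Σ0-cong m (λ i _ → pascal i)) ⟩
  ⟦ suc m C 0 ⟧ * 1ℚ + Σ0 m (λ i → ⟦ suc m C suc i ⟧ * x ^ℚ suc i)
    ≡⟨ sym (Σ0-suc-head m (λ i → ⟦ suc m C i ⟧ * x ^ℚ i)) ⟩
  Σ0 (suc m) (λ i → ⟦ suc m C i ⟧ * x ^ℚ i) ∎
  where
  f = λ i → ⟦ m C i ⟧ * x ^ℚ i
  distrib : ∀ (a b : ℚ) → (a + 1ℚ) * b ≡ a * b + b
  distrib = solve-∀ ℚ-ring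
  comm-left : ∀ (a c d : ℚ) → a * (c * d) ≡ c * (a * d)
  comm-left = solve-∀ ℚ-ring
  swap-one : ∀ (a b : ℚ) → a + (1ℚ + b) ≡ 1ℚ + (a + b)
  swap-one = solve-∀ ℚ-ring
  pascal : ∀ i → ⟦ m C i ⟧ * x ^ℚ suc i + ⟦ m C suc i ⟧ * x ^ℚ suc i ≡ ⟦ suc m C suc i ⟧ * x ^ℚ suc i
  pascal i = trans (sym (ℚₚ.*-distribʳ-+ (x ^ℚ suc i) ⟦ m C i ⟧ ⟦ m C suc i ⟧))
    (cong (_* x ^ℚ suc i) (trans (sym (⟦⟧-homo-+ (m C i) (m C suc i))) (cong ⟦_⟧ (nCk+nC[k+1]≡[n+1]C[k+1] m i))))
  low-terms : Σ0 m f ≡ 1ℚ + Σ0 m (λ i → ⟦ m C suc i ⟧ * x ^ℚ suc i)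
  low-terms = begin
    Σ0 m f
      ≡⟨ sym (ℚₚ.+-identityʳ (Σ0 m f)) ⟩
    Σ0 m f + 0ℚ
      ≡⟨ cong (λ u → Σ0 m f + u) (sym vanishing-top) ⟩
    Σ0 (suc m) f
      ≡⟨ Σ0-suc-head m f ⟩
    1ℚ * 1ℚ + Σ0 m (λ i → f (suc i))
      ≡⟨ cong (_+ Σ0 m (λ i → f (suc i))) (ℚₚ.*-identityʳ 1ℚ) ⟩
    1ℚ + Σ0 m (λ i → ⟦ m C suc i ⟧ * x ^ℚ suc i) ∎
    where
    vanishing-top : f (suc m) ≡ 0ℚ
    vanishing-top = trans (cong (λ u → ⟦ u ⟧ * x ^ℚ suc m) (k>n⇒nCk≡0 (ℕₚ.n<1+n m))) (ℚₚ.*-zeroˡ (x ^ℚ suc m))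

Δpow : ℚ → ℕ → ℚ
Δpow x e = (x + 1ℚ) ^ℚ suc e - x ^ℚ suc e

Δpow≡Σ0 : ∀ (x : ℚ) e → Δpow x e ≡ Σ0 e (λ i → ⟦ suc e C i ⟧ * x ^ℚ i)
Δpow≡Σ0 x e = begin
  (x + 1ℚ) ^ℚ suc e - x ^ℚ suc e
    ≡⟨ cong (_- x ^ℚ suc e) (binomial-theorem x (suc e)) ⟩
  S + ⟦ suc e C suc e ⟧ * x ^ℚ suc e - x ^ℚ suc e
    ≡⟨ cong (λ u → S + ⟦ u ⟧ * x ^ℚ suc e - x ^ℚ suc e) (nCn≡1 (suc e)) ⟩
  S + 1ℚ * x ^ℚ suc e - x ^ℚ suc e
    ≡⟨ cancel S (x ^ℚ suc e) ⟩
  S ∎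
  where
  S = Σ0 e (λ i → ⟦ suc e C i ⟧ * x ^ℚ i)
  cancel : ∀ (a b : ℚ) → a + 1ℚ * b - b ≡ a
  cancel = solve-∀ ℚ-ring

β : ℕ → ℕ → ℚ
β N j = inv N * ⟦ N C j ⟧ * B j

β-top : ∀ p → β (suc p) p ≡ B p
β-top p = begin
  inv (suc p) * ⟦ suc p C p ⟧ * B p   ≡⟨ cong (λ u → inv (suc p) * ⟦ u ⟧ * B p) ([1+m]Cm≡1+m p) ⟩
  inv (suc p) * ⟦ suc p ⟧ * B p       ≡⟨ cong (_* B p) (inv-inverseˡ p) ⟩
  1ℚ * B p                            ≡⟨ ℚₚ.*-identityˡ (B p) ⟩
  B p                                 ∎

β-below-top : ∀ m → β (3 ℕ.+ m) (suc m) ≡ ⟦ 2 ℕ.+ m ⟧ * ½ * B (suc m)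
β-below-top m = cong (_* B (suc m)) (begin
  inv N * ⟦ N C suc m ⟧
    ≡⟨ cong (inv N *_) (sym (ℚₚ.*-identityˡ ⟦ N C suc m ⟧)) ⟩
  inv N * (½ * ⟦ 2 ⟧ * ⟦ N C suc m ⟧)
    ≡⟨ cong (inv N *_) (trans (ℚₚ.*-assoc ½ ⟦ 2 ⟧ ⟦ N C suc m ⟧) (cong (½ *_) twice-binomial)) ⟩
  inv N * (½ * (⟦ N ⟧ * ⟦ 2 ℕ.+ m ⟧))
    ≡⟨ regroup (inv N) ½ ⟦ N ⟧ ⟦ 2 ℕ.+ m ⟧ ⟩
  (inv N * ⟦ N ⟧) * (⟦ 2 ℕ.+ m ⟧ * ½)
    ≡⟨ cong (_* (⟦ 2 ℕ.+ m ⟧ * ½)) (inv-inverseˡ (2 ℕ.+ m)) ⟩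
  1ℚ * (⟦ 2 ℕ.+ m ⟧ * ½)
    ≡⟨ ℚₚ.*-identityˡ _ ⟩
  ⟦ 2 ℕ.+ m ⟧ * ½ ∎)
  where
  N = 3 ℕ.+ m
  twice-binomial : ⟦ 2 ⟧ * ⟦ N C suc m ⟧ ≡ ⟦ N ⟧ * ⟦ 2 ℕ.+ m ⟧
  twice-binomial = trans (sym (⟦⟧-homo-* 2 (N C suc m)))
                         (trans (cong ⟦_⟧ (2*[3+k]C[1+k]≡[3+k]*[2+k] m)) (⟦⟧-homo-* N (2 ℕ.+ m)))
  regroup : ∀ (v h a b : ℚ) → v * (h * (a * b)) ≡ (v * a) * (b * h)
  regroup = solve-∀ ℚ-ring

-- The discrete form of  d/dx C^{(q)}(x) = x^q :  ΔC^{(q)}(x) = (x+1)^q.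
Σ0-β-Δpow : ∀ q (x : ℚ) → Σ0 q (λ j → β (suc q) j * Δpow x (q ∸ j)) ≡ (x + 1ℚ) ^ℚ q
Σ0-β-Δpow q x = begin
  Σ0 q (λ j → β (suc q) j * Δpow x (q ∸ j))
    ≡⟨ Σ0-cong q (λ j _ → trans (cong (β (suc q) j *_) (Δpow≡Σ0 x (q ∸ j))) (sym (Σ0-*ˡ (q ∸ j) (β (suc q) j) _))) ⟩
  Σ0 q (λ j → Σ0 (q ∸ j) (λ i → β (suc q) j * (⟦ suc (q ∸ j) C i ⟧ * x ^ℚ i)))
    ≡⟨ Σ0-triangle-swap q (λ j i → β (suc q) j * (⟦ suc (q ∸ j) C i ⟧ * x ^ℚ i)) ⟩
  Σ0 q (λ i → Σ0 (q ∸ i) (λ j → β (suc q) j * (⟦ suc (q ∸ j) C i ⟧ * x ^ℚ i)))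
    ≡⟨ Σ0-cong q (λ i i≤q → Σ0-cong (q ∸ i) (λ j j≤q∸i → exchange i j i≤q j≤q∸i)) ⟩
  Σ0 q (λ i → Σ0 (q ∸ i) (λ j → D i * (⟦ suc (q ∸ i) C j ⟧ * B j)))
    ≡⟨ Σ0-cong q (λ i _ → trans (Σ0-*ˡ (q ∸ i) (D i) _) (cong (D i *_) (bernoulli-recurrence (q ∸ i)))) ⟩
  Σ0 q (λ i → D i * ⟦ suc (q ∸ i) ⟧)
    ≡⟨ Σ0-cong q (λ i i≤q → absorb i i≤q) ⟩
  Σ0 q (λ i → ⟦ q C i ⟧ * x ^ℚ i)
    ≡⟨ sym (binomial-theorem x q) ⟩
  (x + 1ℚ) ^ℚ q ∎
  where
  iv = inv (suc q)
  D = λ i → iv * ⟦ suc q C i ⟧ * x ^ℚ i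
  regroupˡ : ∀ (v a b c X : ℚ) → v * a * b * (c * X) ≡ v * X * b * (a * c)
  regroupˡ = solve-∀ ℚ-ring
  regroupʳ : ∀ (v X b d e : ℚ) → v * X * b * (d * e) ≡ v * d * X * (e * b)
  regroupʳ = solve-∀ ℚ-ring
  exchange : ∀ i j → i ≤ q → j ≤ q ∸ i →
             β (suc q) j * (⟦ suc (q ∸ j) C i ⟧ * x ^ℚ i) ≡ D i * (⟦ suc (q ∸ i) C j ⟧ * B j)
  exchange i j i≤q j≤q∸i = begin
    β (suc q) j * (⟦ suc (q ∸ j) C i ⟧ * x ^ℚ i)
      ≡⟨ regroupˡ iv ⟦ suc q C j ⟧ (B j) ⟦ suc (q ∸ j) C i ⟧ (x ^ℚ i) ⟩
    iv * x ^ℚ i * B j * (⟦ suc q C j ⟧ * ⟦ suc (q ∸ j) C i ⟧)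
      ≡⟨ cong (iv * x ^ℚ i * B j *_) (trans (sym (⟦⟧-homo-* (suc q C j) (suc (q ∸ j) C i)))
                                     (trans (cong ⟦_⟧ binomials) (⟦⟧-homo-* (suc q C i) (suc (q ∸ i) C j)))) ⟩
    iv * x ^ℚ i * B j * (⟦ suc q C i ⟧ * ⟦ suc (q ∸ i) C j ⟧)
      ≡⟨ regroupʳ iv (x ^ℚ i) (B j) ⟦ suc q C i ⟧ ⟦ suc (q ∸ i) C j ⟧ ⟩
    D i * (⟦ suc (q ∸ i) C j ⟧ * B j) ∎
    where
    i+j≤q : i ℕ.+ j ≤ q
    i+j≤q = subst (i ℕ.+ j ≤_) (ℕₚ.m+[n∸m]≡n i≤q) (ℕₚ.+-monoʳ-≤ i j≤q∸i)
    binomials : (suc q C j) ℕ.* (suc (q ∸ j) C i) ≡ (suc q C i) ℕ.* (suc (q ∸ i) C j)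
    binomials = subst₂ (λ u v → (suc q C j) ℕ.* (u C i) ≡ (suc q C i) ℕ.* (v C j))
                  (suc-∸ (ℕₚ.≤-trans j≤q∸i (ℕₚ.m∸n≤m q i))) (suc-∸ i≤q)
                  (nCj*[n∸j]Ci≡nCi*[n∸i]Cj (suc q) i j (ℕₚ.m≤n⇒m≤1+n i+j≤q))
  regroup₁ : ∀ (v a X s : ℚ) → v * a * X * s ≡ v * (a * s) * X
  regroup₁ = solve-∀ ℚ-ring
  regroup₂ : ∀ (v y a X : ℚ) → v * (y * a) * X ≡ (v * y) * a * X
  regroup₂ = solve-∀ ℚ-ring
  absorb : ∀ i → i ≤ q → D i * ⟦ suc (q ∸ i) ⟧ ≡ ⟦ q C i ⟧ * x ^ℚ i
  absorb i i≤q = begin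
    iv * ⟦ suc q C i ⟧ * x ^ℚ i * ⟦ suc (q ∸ i) ⟧
      ≡⟨ regroup₁ iv ⟦ suc q C i ⟧ (x ^ℚ i) ⟦ suc (q ∸ i) ⟧ ⟩
    iv * (⟦ suc q C i ⟧ * ⟦ suc (q ∸ i) ⟧) * x ^ℚ i
      ≡⟨ cong (λ u → iv * u * x ^ℚ i) (trans (sym (⟦⟧-homo-* (suc q C i) (suc (q ∸ i))))
                  (trans (cong ⟦_⟧ ([1+q]Ci*[1+q∸i]≡[1+q]*qCi q i i≤q)) (⟦⟧-homo-* (suc q) (q C i)))) ⟩
    iv * (⟦ suc q ⟧ * ⟦ q C i ⟧) * x ^ℚ i
      ≡⟨ regroup₂ iv ⟦ suc q ⟧ ⟦ q C i ⟧ (x ^ℚ i) ⟩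
    (iv * ⟦ suc q ⟧) * ⟦ q C i ⟧ * x ^ℚ i
      ≡⟨ cong (λ u → u * ⟦ q C i ⟧ * x ^ℚ i) (inv-inverseˡ q) ⟩
    1ℚ * ⟦ q C i ⟧ * x ^ℚ i
      ≡⟨ cong (_* x ^ℚ i) (ℚₚ.*-identityˡ ⟦ q C i ⟧) ⟩
    ⟦ q C i ⟧ * x ^ℚ i ∎

∸-shuffle : ∀ p a s t → p ∸ a ∸ (t ℕ.+ s) ≡ p ∸ s ∸ a ∸ t
∸-shuffle p a s t = begin
  p ∸ a ∸ (t ℕ.+ s)     ≡⟨ ℕₚ.∸-+-assoc p a (t ℕ.+ s) ⟩
  p ∸ (a ℕ.+ (t ℕ.+ s)) ≡⟨ cong (p ∸_) (reorder a s t) ⟩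
  p ∸ (s ℕ.+ a ℕ.+ t)   ≡⟨ sym (ℕₚ.∸-+-assoc p (s ℕ.+ a) t) ⟩
  p ∸ (s ℕ.+ a) ∸ t     ≡⟨ cong (_∸ t) (sym (ℕₚ.∸-+-assoc p s a)) ⟩
  p ∸ s ∸ a ∸ t         ∎
  where
  reorder : ∀ a s t → a ℕ.+ (t ℕ.+ s) ≡ s ℕ.+ a ℕ.+ t
  reorder = ℕ-Solver.solve-∀

suc-∸-∸ : ∀ {p a s} → a ℕ.+ s ≤ p → suc p ∸ a ∸ s ≡ suc (p ∸ a ∸ s)
suc-∸-∸ {p} {a} {s} a+s≤p =
  trans (cong (_∸ s) (suc-∸ (ℕₚ.m+n≤o⇒m≤o a a+s≤p)))
        (suc-∸ (ℕₚ.m+n≤o⇒m≤o∸n s (subst (_≤ p) (ℕₚ.+-comm a s) a+s≤p)))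

+-≤-∸-∸ : ∀ {p a s j} → a ℕ.+ s ≤ p → j ≤ p ∸ a ∸ s → a ℕ.+ (s ℕ.+ j) ≤ p
+-≤-∸-∸ {p} {a} {s} {j} a+s≤p j≤ =
  subst (_≤ p) (reorder j a s) (ℕₚ.m≤o∸n⇒m+n≤o j a+s≤p (subst (j ≤_) (ℕₚ.∸-+-assoc p a s) j≤))
  where
  reorder : ∀ j a s → j ℕ.+ (a ℕ.+ s) ≡ a ℕ.+ (s ℕ.+ j)
  reorder = ℕ-Solver.solve-∀

-- A public copy of the private `go` of Defs: for a concrete index list, `Cgen` unfolds to
-- `nested p a_r mon (0 ∷ a₂ ∷ … ∷ a_r ∷ []) 0`, where `Cp` takes mon e = x^{e+1}.
nested : (p aR : ℕ) → (ℕ → ℚ) → List ℕ → ℕ → ℚ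
nested p aR mon []       s = mon (p ∸ aR ∸ s)
nested p aR mon (a ∷ as) s = Σ0 (p ∸ aR ∸ s) (λ j → β (suc p ∸ a ∸ s) j * nested p aR mon as (s ℕ.+ j))

nested-minus : ∀ p aR (f g : ℕ → ℚ) as s →
  nested p aR (λ e → f e - g e) as s ≡ nested p aR f as s - nested p aR g as s
nested-minus p aR f g []       s = refl
nested-minus p aR f g (a ∷ as) s =
  trans (Σ0-cong (p ∸ aR ∸ s) (λ j _ → trans (cong (w j *_) (nested-minus p aR f g as (s ℕ.+ j)))
                                            (distrib (w j) (nested p aR f as (s ℕ.+ j)) (nested p aR g as (s ℕ.+ j)))))
        (Σ0-minus (p ∸ aR ∸ s) (λ j → w j * nested p aR f as (s ℕ.+ j)) (λ j → w j * nested p aR g as (s ℕ.+ j)))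
  where
  w = β (suc p ∸ a ∸ s)
  distrib : ∀ (a b c : ℚ) → a * (b - c) ≡ a * b - a * c
  distrib = solve-∀ ℚ-ring

nested-scale : ∀ p aR (y : ℚ) (f : ℕ → ℚ) as s → nested p aR (λ e → y * f e) as s ≡ y * nested p aR f as s
nested-scale p aR y f []       s = refl
nested-scale p aR y f (a ∷ as) s =
  trans (Σ0-cong (p ∸ aR ∸ s) (λ j _ → trans (cong (w j *_) (nested-scale p aR y f as (s ℕ.+ j)))
                                            (comm-left (w j) y (nested p aR f as (s ℕ.+ j)))))
        (Σ0-*ˡ (p ∸ aR ∸ s) y (λ j → w j * nested p aR f as (s ℕ.+ j)))
  where
  w = β (suc p ∸ a ∸ s)
  comm-left : ∀ (a b c : ℚ) → a * (b * c) ≡ b * (a * c)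
  comm-left = solve-∀ ℚ-ring

nested-zero : ∀ p aR (f : ℕ → ℚ) as s → (∀ e → f e ≡ 0ℚ) → nested p aR f as s ≡ 0ℚ
nested-zero p aR f []       s f≡0 = f≡0 (p ∸ aR ∸ s)
nested-zero p aR f (a ∷ as) s f≡0 =
  Σ0-zero (p ∸ aR ∸ s) (λ j → w j * nested p aR f as (s ℕ.+ j))
    (λ j → trans (cong (w j *_) (nested-zero p aR f as (s ℕ.+ j) f≡0)) (ℚₚ.*-zeroʳ (w j)))
  where
  w = β (suc p ∸ a ∸ s)

nested-shift : ∀ {p s} → s ≤ p → ∀ aR mon as t → nested p aR mon as (t ℕ.+ s) ≡ nested (p ∸ s) aR mon as t
nested-shift {p} {s} s≤p aR mon []       t = cong mon (∸-shuffle p aR s t)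
nested-shift {p} {s} s≤p aR mon (a ∷ as) t =
  trans (cong (λ n → Σ0 n (λ j → β (suc p ∸ a ∸ (t ℕ.+ s)) j * nested p aR mon as (t ℕ.+ s ℕ.+ j)))
              (∸-shuffle p aR s t))
        (Σ0-cong (p ∸ s ∸ aR ∸ t) (λ j _ →
          cong₂ _*_ (cong (λ N → β N j) (trans (∸-shuffle (suc p) a s t) (cong (λ n → n ∸ a ∸ t) (suc-∸ s≤p))))
                    (trans (cong (nested p aR mon as) (reorder t s j)) (nested-shift s≤p aR mon as (t ℕ.+ j)))))
  where
  reorder : ∀ t s j → t ℕ.+ s ℕ.+ j ≡ t ℕ.+ j ℕ.+ s
  reorder = ℕ-Solver.solve-∀

-- Only the innermost sum feels the difference operator, and it collapses by Σ0-β-Δpow.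
nested-Δpow : ∀ p aR (x : ℚ) as s → aR ℕ.+ s ≤ p →
  nested p aR (Δpow x) (as ++ [ aR ]) s ≡ nested p aR ((x + 1ℚ) ^ℚ_) as s
nested-Δpow p aR x []       s aR+s≤p = trans
  (Σ0-cong (p ∸ aR ∸ s) (λ j _ → cong₂ (λ N e → β N j * Δpow x e)
    (suc-∸-∸ {p} {aR} {s} aR+s≤p) (sym (ℕₚ.∸-+-assoc (p ∸ aR) s j))))
  (Σ0-β-Δpow (p ∸ aR ∸ s) x)
nested-Δpow p aR x (a ∷ as) s aR+s≤p = Σ0-cong (p ∸ aR ∸ s) (λ j j≤ →
  cong (β (suc p ∸ a ∸ s) j *_) (nested-Δpow p aR x as (s ℕ.+ j) (+-≤-∸-∸ {p} {aR} {s} {j} aR+s≤p j≤)))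

^ℚ-+ : ∀ (y : ℚ) a b → y ^ℚ (a ℕ.+ b) ≡ y ^ℚ a * y ^ℚ b
^ℚ-+ y zero    b = sym (ℚₚ.*-identityˡ (y ^ℚ b))
^ℚ-+ y (suc a) b = trans (cong (y *_) (^ℚ-+ y a b)) (sym (ℚₚ.*-assoc y (y ^ℚ a) (y ^ℚ b)))

^ℚ-suc-n∸n : ∀ (y : ℚ) m → y ^ℚ suc (m ∸ m) ≡ y
^ℚ-suc-n∸n y m = trans (cong (λ e → y ^ℚ suc e) (ℕₚ.n∸n≡0 m)) (ℚₚ.*-identityʳ y)

Σ0-pow-lift : ∀ (y : ℚ) t m (c : ℕ → ℚ) →
  Σ0 m (λ j → c j * y ^ℚ (t ℕ.+ (m ∸ j))) ≡ y ^ℚ t * Σ0 m (λ j → c j * y ^ℚ (m ∸ j))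
Σ0-pow-lift y t m c = trans
  (Σ0-cong m (λ j _ → trans (cong (c j *_) (^ℚ-+ y t (m ∸ j))) (comm-left (c j) (y ^ℚ t) (y ^ℚ (m ∸ j)))))
  (Σ0-*ˡ m (y ^ℚ t) (λ j → c j * y ^ℚ (m ∸ j)))
  where
  comm-left : ∀ (a b c : ℚ) → a * (b * c) ≡ b * (a * c)
  comm-left = solve-∀ ℚ-ring

Cp-0 : ∀ y → Cp 0 [] y ≡ y
Cp-0 y = unit y
  where
  unit : ∀ y → 1ℚ * (y * 1ℚ) ≡ y
  unit = solve-∀ ℚ-ring

Cp-1 : ∀ y → Cp 1 [] y ≡ ½ * (y * y) + ½ * y
Cp-1 y = unit y
  where
  unit : ∀ y → ½ * (y * (y * 1ℚ)) + ½ * (y * 1ℚ) ≡ ½ * (y * y) + ½ * y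
  unit = solve-∀ ℚ-ring

peel₁ : ∀ (y : ℚ) q → 1 ≤ q → y * (y * nested q 1 (y ^ℚ_) (0 ∷ []) 0) ≡ Cp q [] y - B q * y
peel₁ y (suc m) _ = begin
  y * (y * S)                                       ≡⟨ rearrange y S (B (suc m)) ⟩
  y * (y * 1ℚ) * S + B (suc m) * y - B (suc m) * y  ≡⟨ cong₂ (λ u v → u + v - B (suc m) * y) (sym lower) (sym top) ⟩
  Cp (suc m) [] y - B (suc m) * y                   ∎
  where
  S = Σ0 m (λ j → β (2 ℕ.+ m) j * y ^ℚ (m ∸ j))
  rearrange : ∀ (y S b : ℚ) → y * (y * S) ≡ y * (y * 1ℚ) * S + b * y - b * y
  rearrange = solve-∀ ℚ-ring
  lower : Σ0 m (λ j → β (2 ℕ.+ m) j * y ^ℚ suc (suc m ∸ j)) ≡ y ^ℚ 2 * S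
  lower = trans (Σ0-cong m (λ j j≤m → cong (λ e → β (2 ℕ.+ m) j * y ^ℚ suc e) (suc-∸ j≤m)))
                (Σ0-pow-lift y 2 m (β (2 ℕ.+ m)))
  top : β (2 ℕ.+ m) (suc m) * y ^ℚ suc (suc m ∸ suc m) ≡ B (suc m) * y
  top = cong₂ _*_ (β-top (suc m)) (^ℚ-suc-n∸n y m)

peel₂ : ∀ (y : ℚ) m → y * (y * (y * nested (2 ℕ.+ m) 2 (y ^ℚ_) (0 ∷ []) 0))
                       ≡ Cp (2 ℕ.+ m) [] y - ⟦ 2 ℕ.+ m ⟧ * ½ * B (suc m) * (y * y) - B (2 ℕ.+ m) * y
peel₂ y m = begin
  y * (y * (y * S))
    ≡⟨ rearrange y S c b ⟩
  y * (y * (y * 1ℚ)) * S + c * (y * y) + b * y - c * (y * y) - b * y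
    ≡⟨ cong₂ (λ u v → u + v - c * (y * y) - b * y) (cong₂ _+_ (sym lower) (sym middle)) (sym top) ⟩
  Cp (2 ℕ.+ m) [] y - c * (y * y) - b * y ∎
  where
  S = Σ0 m (λ j → β (3 ℕ.+ m) j * y ^ℚ (m ∸ j))
  c = ⟦ 2 ℕ.+ m ⟧ * ½ * B (suc m)
  b = B (2 ℕ.+ m)
  rearrange : ∀ (y S c b : ℚ) → y * (y * (y * S)) ≡ y * (y * (y * 1ℚ)) * S + c * (y * y) + b * y - c * (y * y) - b * y
  rearrange = solve-∀ ℚ-ring
  square : ∀ (y : ℚ) → y * (y * 1ℚ) ≡ y * y
  square = solve-∀ ℚ-ring
  lower : Σ0 m (λ j → β (3 ℕ.+ m) j * y ^ℚ suc (2 ℕ.+ m ∸ j)) ≡ y ^ℚ 3 * S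
  lower = trans (Σ0-cong m (λ j j≤m → cong (λ e → β (3 ℕ.+ m) j * y ^ℚ suc e)
                                           (trans (suc-∸ (ℕₚ.m≤n⇒m≤1+n j≤m)) (cong suc (suc-∸ j≤m)))))
                (Σ0-pow-lift y 3 m (β (3 ℕ.+ m)))
  middle : β (3 ℕ.+ m) (suc m) * y ^ℚ suc (2 ℕ.+ m ∸ suc m) ≡ c * (y * y)
  middle = cong₂ _*_ (β-below-top m) (trans (cong (λ e → y ^ℚ suc e) (ℕₚ.m+n∸n≡m 1 m)) (square y))
  top : β (3 ℕ.+ m) (2 ℕ.+ m) * y ^ℚ suc (2 ℕ.+ m ∸ (2 ℕ.+ m)) ≡ b * y
  top = cong₂ _*_ (β-top (2 ℕ.+ m)) (^ℚ-suc-n∸n y m)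

module _ (x : ℚ) where
  private
    Y : ℚ
    Y = x + 1ℚ

  nested-difference : ∀ p aR as → aR ≤ p →
    nested p aR (λ e → Y ^ℚ suc e) (as ++ [ aR ]) 0 - nested p aR (λ e → x ^ℚ suc e) (as ++ [ aR ]) 0
      ≡ nested p aR (Y ^ℚ_) as 0
  nested-difference p aR as aR≤p =
    trans (sym (nested-minus p aR (λ e → Y ^ℚ suc e) (λ e → x ^ℚ suc e) (as ++ [ aR ]) 0))
          (nested-Δpow p aR x as 0 (subst (_≤ p) (sym (ℕₚ.+-identityʳ aR)) aR≤p))

  ΔCp : ∀ p → Cp p [] Y - Cp p [] x ≡ Y ^ℚ p
  ΔCp p = nested-difference p 0 [] z≤n

  ΔCp₀ : ∀ p → Y * (Cp p (0 ∷ []) Y - Cp p (0 ∷ []) x) ≡ Cp p [] Y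
  ΔCp₀ p = trans (cong (Y *_) (nested-difference p 0 (0 ∷ []) z≤n)) (sym (nested-scale p 0 Y (Y ^ℚ_) (0 ∷ []) 0))

  -- For p < a_r, Cgen makes C^{(p)}_{…,a_r} the empty sum: definitionally 0ℚ.
  ΔCp₁₁ : ∀ p → Y * (Cp p (1 ∷ 1 ∷ []) Y - Cp p (1 ∷ 1 ∷ []) x) ≡ Cp p (1 ∷ []) Y
  ΔCp₁₁ zero    = zero-case Y
    where
    zero-case : ∀ (y : ℚ) → y * (0ℚ - 0ℚ) ≡ 0ℚ
    zero-case = solve-∀ ℚ-ring
  ΔCp₁₁ (suc k) = trans (cong (Y *_) (nested-difference (suc k) 1 (0 ∷ 1 ∷ []) (s≤s z≤n)))
                        (sym (nested-scale (suc k) 1 Y (Y ^ℚ_) (0 ∷ 1 ∷ []) 0))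

  ΔCp₁ : ∀ p → Y * (Y * (Cp p (1 ∷ []) Y - Cp p (1 ∷ []) x)) ≡ Cp p [] Y - B p * Y
  ΔCp₁ zero    = trans (zero-case Y) (cong (_- 1ℚ * Y) (sym (Cp-0 Y)))
    where
    zero-case : ∀ (y : ℚ) → y * (y * (0ℚ - 0ℚ)) ≡ y - 1ℚ * y
    zero-case = solve-∀ ℚ-ring
  ΔCp₁ (suc k) = trans (cong (λ u → Y * (Y * u)) (nested-difference (suc k) 1 (0 ∷ []) (s≤s z≤n)))
                       (peel₁ Y (suc k) (s≤s z≤n))

  ΔCp₂ : ∀ p → Y * (Y * (Y * (Cp p (2 ∷ []) Y - Cp p (2 ∷ []) x)))
                 ≡ Cp p [] Y - ⟦ p ⟧ * ½ * B (p ∸ 1) * (Y * Y) - B p * Y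
  ΔCp₂ zero          = trans (zero-case Y) (cong (λ u → u - 0ℚ * (Y * Y) - 1ℚ * Y) (sym (Cp-0 Y)))
    where
    zero-case : ∀ (y : ℚ) → y * (y * (y * (0ℚ - 0ℚ))) ≡ y - 0ℚ * (y * y) - 1ℚ * y
    zero-case = solve-∀ ℚ-ring
  ΔCp₂ (suc zero)    = trans (one-case Y) (cong (λ u → u - ½ * (Y * Y) - ½ * Y) (sym (Cp-1 Y)))
    where
    one-case : ∀ (y : ℚ) → y * (y * (y * (0ℚ - 0ℚ))) ≡ ½ * (y * y) + ½ * y - ½ * (y * y) - ½ * y
    one-case = solve-∀ ℚ-ring
  ΔCp₂ (suc (suc m)) = trans (cong (λ u → Y * (Y * (Y * u))) (nested-difference (2 ℕ.+ m) 2 (0 ∷ []) (s≤s (s≤s z≤n))))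
                             (peel₂ Y m)

  Cp-tail : ∀ p j → j ≤ p → nested p 0 (λ e → Y ^ℚ suc e) (0 ∷ []) j ≡ Cp (p ∸ j) [] Y
  Cp-tail p j j≤p = nested-shift j≤p 0 (λ e → Y ^ℚ suc e) (0 ∷ []) 0

  -- Each inner sum of C^{(p)}_{0,1} is the inner sum of some C^{(q)}_1, so peel₁ applies termwise;
  -- the top terms j = p of C^{(p)}_0 and of D^{(p)}(B) account for the rest.
  ΔCp₀₁ : ∀ p → Y * (Y * (Cp p (0 ∷ 1 ∷ []) Y - Cp p (0 ∷ 1 ∷ []) x)) ≡ Cp p (0 ∷ []) Y - DpB p * Y
  ΔCp₀₁ zero    = zero-case Y
    where
    zero-case : ∀ (y : ℚ) → y * (y * (0ℚ - 0ℚ)) ≡ 1ℚ * (1ℚ * (y * 1ℚ)) - 1ℚ * y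
    zero-case = solve-∀ ℚ-ring
  ΔCp₀₁ (suc k) = begin
    Y * (Y * (Cp P (0 ∷ 1 ∷ []) Y - Cp P (0 ∷ 1 ∷ []) x))
      ≡⟨ cong (λ u → Y * (Y * u)) (nested-difference P 1 (0 ∷ 0 ∷ []) (s≤s z≤n)) ⟩
    Y * (Y * Σ0 k (λ j → w j * inner j))
      ≡⟨ sym (trans (Σ0-*ˡ k Y (λ j → Y * (w j * inner j))) (cong (Y *_) (Σ0-*ˡ k Y (λ j → w j * inner j)))) ⟩
    Σ0 k (λ j → Y * (Y * (w j * inner j)))
      ≡⟨ Σ0-cong k (λ j j≤k → termwise j j≤k) ⟩
    Σ0 k (λ j → w j * Cp (P ∸ j) [] Y - w j * B (P ∸ j) * Y)
      ≡⟨ trans (Σ0-minus k _ _) (cong (S₁ -_) (Σ0-*ʳ k Y (λ j → w j * B (P ∸ j)))) ⟩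
    S₁ - S₂ * Y
      ≡⟨ split-top S₁ S₂ (B P) Y ⟩
    (S₁ + B P * Y) - (S₂ + B P * 1ℚ) * Y
      ≡⟨ cong₂ (λ u v → u - v * Y) (sym Cp₀-split) (sym DpB-split) ⟩
    Cp P (0 ∷ []) Y - DpB P * Y ∎
    where
    P = suc k
    w = β (suc P)
    inner : ℕ → ℚ
    inner j = nested P 1 (Y ^ℚ_) (0 ∷ []) j
    S₁ = Σ0 k (λ j → w j * Cp (P ∸ j) [] Y)
    S₂ = Σ0 k (λ j → w j * B (P ∸ j))
    split-top : ∀ (s₁ s₂ b y : ℚ) → s₁ - s₂ * y ≡ (s₁ + b * y) - (s₂ + b * 1ℚ) * y
    split-top = solve-∀ ℚ-ring
    comm-left₂ : ∀ (y c w : ℚ) → y * (y * (c * w)) ≡ c * (y * (y * w))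
    comm-left₂ = solve-∀ ℚ-ring
    distrib : ∀ (c f b y : ℚ) → c * (f - b * y) ≡ c * f - c * b * y
    distrib = solve-∀ ℚ-ring
    termwise : ∀ j → j ≤ k → Y * (Y * (w j * inner j)) ≡ w j * Cp (P ∸ j) [] Y - w j * B (P ∸ j) * Y
    termwise j j≤k = begin
      Y * (Y * (w j * inner j))
        ≡⟨ comm-left₂ Y (w j) (inner j) ⟩
      w j * (Y * (Y * inner j))
        ≡⟨ cong (λ u → w j * (Y * (Y * u))) (nested-shift (ℕₚ.m≤n⇒m≤1+n j≤k) 1 (Y ^ℚ_) (0 ∷ []) 0) ⟩
      w j * (Y * (Y * nested (P ∸ j) 1 (Y ^ℚ_) (0 ∷ []) 0))
        ≡⟨ cong (w j *_) (peel₁ Y (P ∸ j) (subst (1 ≤_) (sym (suc-∸ j≤k)) (s≤s z≤n))) ⟩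
      w j * (Cp (P ∸ j) [] Y - B (P ∸ j) * Y)
        ≡⟨ distrib (w j) (Cp (P ∸ j) [] Y) (B (P ∸ j)) Y ⟩
      w j * Cp (P ∸ j) [] Y - w j * B (P ∸ j) * Y ∎
    Cp₀-split : Cp P (0 ∷ []) Y ≡ S₁ + B P * Y
    Cp₀-split = cong₂ _+_
      (Σ0-cong k (λ j j≤k → cong (w j *_) (Cp-tail P j (ℕₚ.m≤n⇒m≤1+n j≤k))))
      (cong₂ _*_ (β-top P) (trans (Cp-tail P P ℕₚ.≤-refl) (trans (cong (λ q → Cp q [] Y) (ℕₚ.n∸n≡0 k)) (Cp-0 Y))))
    DpB-split : DpB P ≡ S₂ + B P * 1ℚ
    DpB-split = cong (λ u → S₂ + u) (cong₂ _*_ (β-top P) (cong B (ℕₚ.n∸n≡0 k)))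

module _ {Y iy : ℚ} (Y*iy≡1 : Y * iy ≡ 1ℚ) where

  divide : ∀ {d r} → Y * d ≡ r → d ≡ r * iy
  divide {d} {r} Y*d≡r = begin
    d             ≡⟨ sym (ℚₚ.*-identityʳ d) ⟩
    d * 1ℚ        ≡⟨ cong (d *_) (sym Y*iy≡1) ⟩
    d * (Y * iy)  ≡⟨ regroup d Y iy ⟩
    Y * d * iy    ≡⟨ cong (_* iy) Y*d≡r ⟩
    r * iy        ∎
    where
    regroup : ∀ (d Y iy : ℚ) → d * (Y * iy) ≡ Y * d * iy
    regroup = solve-∀ ℚ-ring

  cancel : ∀ z → z * Y * iy ≡ z
  cancel z = trans (ℚₚ.*-assoc z Y iy) (trans (cong (z *_) Y*iy≡1) (ℚₚ.*-identityʳ z))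

-≡⇒≡+ : ∀ {a b d : ℚ} → a - b ≡ d → a ≡ b + d
-≡⇒≡+ {a} {b} refl = split a b
  where
  split : ∀ (a b : ℚ) → a ≡ b + (a - b)
  split = solve-∀ ℚ-ring

module _ (x iy : ℚ) (Y*iy≡1 : (x + 1ℚ) * iy ≡ 1ℚ) where
  private
    Y : ℚ
    Y = x + 1ℚ

  Cp₀-step : ∀ p → Cp p (0 ∷ []) Y ≡ Cp p (0 ∷ []) x + Cp p [] Y * iy
  Cp₀-step p = -≡⇒≡+ (divide {Y} Y*iy≡1 (ΔCp₀ x p))

  Cp₁₁-step : ∀ p → Cp p (1 ∷ 1 ∷ []) Y ≡ Cp p (1 ∷ 1 ∷ []) x + Cp p (1 ∷ []) Y * iy
  Cp₁₁-step p = -≡⇒≡+ (divide {Y} Y*iy≡1 (ΔCp₁₁ x p))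

  Cp₁-step : ∀ p → Cp p (1 ∷ []) Y ≡ Cp p (1 ∷ []) x + (Cp p [] Y * iy * iy - B p * iy)
  Cp₁-step p = -≡⇒≡+ (begin
    Cp p (1 ∷ []) Y - Cp p (1 ∷ []) x  ≡⟨ divide {Y} Y*iy≡1 (divide {Y} Y*iy≡1 (ΔCp₁ x p)) ⟩
    (T - b * Y) * iy * iy              ≡⟨ expand T b Y iy ⟩
    T * iy * iy - b * Y * iy * iy      ≡⟨ cong (λ u → T * iy * iy - u * iy) (cancel {Y} Y*iy≡1 b) ⟩
    T * iy * iy - b * iy               ∎)
    where
    T = Cp p [] Y
    b = B p
    expand : ∀ (T b Y iy : ℚ) → (T - b * Y) * iy * iy ≡ T * iy * iy - b * Y * iy * iy
    expand = solve-∀ ℚ-ring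

  Cp₂-step : ∀ p → Cp p (2 ∷ []) Y
    ≡ Cp p (2 ∷ []) x + (Cp p [] Y * iy * iy * iy - B p * iy * iy - ⟦ p ⟧ * ½ * B (p ∸ 1) * iy)
  Cp₂-step p = -≡⇒≡+ (begin
    Cp p (2 ∷ []) Y - Cp p (2 ∷ []) x
      ≡⟨ divide {Y} Y*iy≡1 (divide {Y} Y*iy≡1 (divide {Y} Y*iy≡1 (ΔCp₂ x p))) ⟩
    (T - c * (Y * Y) - b * Y) * iy * iy * iy
      ≡⟨ expand T b c Y iy ⟩
    T * iy * iy * iy - b * Y * iy * iy * iy - c * Y * iy * Y * iy * iy
      ≡⟨ cong₂ (λ u v → T * iy * iy * iy - u * iy * iy - v * iy)
               (cancel {Y} Y*iy≡1 b) (trans (cong (λ u → u * Y * iy) (cancel {Y} Y*iy≡1 c)) (cancel {Y} Y*iy≡1 c)) ⟩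
    T * iy * iy * iy - b * iy * iy - c * iy ∎)
    where
    T = Cp p [] Y
    b = B p
    c = ⟦ p ⟧ * ½ * B (p ∸ 1)
    expand : ∀ (T b c Y iy : ℚ) →
      (T - c * (Y * Y) - b * Y) * iy * iy * iy ≡ T * iy * iy * iy - b * Y * iy * iy * iy - c * Y * iy * Y * iy * iy
    expand = solve-∀ ℚ-ring

  Cp₀₁-step : ∀ p → Cp p (0 ∷ 1 ∷ []) Y ≡ Cp p (0 ∷ 1 ∷ []) x + (Cp p (0 ∷ []) Y * iy * iy - DpB p * iy)
  Cp₀₁-step p = -≡⇒≡+ (begin
    Cp p (0 ∷ 1 ∷ []) Y - Cp p (0 ∷ 1 ∷ []) x  ≡⟨ divide {Y} Y*iy≡1 (divide {Y} Y*iy≡1 (ΔCp₀₁ x p)) ⟩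
    (T - D * Y) * iy * iy                      ≡⟨ expand T D Y iy ⟩
    T * iy * iy - D * Y * iy * iy              ≡⟨ cong (λ u → T * iy * iy - u * iy) (cancel {Y} Y*iy≡1 D) ⟩
    T * iy * iy - D * iy                       ∎)
    where
    T = Cp p (0 ∷ []) Y
    D = DpB p
    expand : ∀ (T b Y iy : ℚ) → (T - b * Y) * iy * iy ≡ T * iy * iy - b * Y * iy * iy
    expand = solve-∀ ℚ-ring

zero-^ℚ-suc : ∀ e → ⟦ 0 ⟧ ^ℚ suc e ≡ 0ℚ
zero-^ℚ-suc e = ℚₚ.*-zeroˡ (⟦ 0 ⟧ ^ℚ e)

faulhaber : ∀ p n → Hneg p n ≡ Cp p [] ⟦ n ⟧
faulhaber p zero    = sym (nested-zero p 0 (λ e → ⟦ 0 ⟧ ^ℚ suc e) (0 ∷ []) 0 zero-^ℚ-suc)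
faulhaber p (suc n) = begin
  Hneg p n + ⟦ suc n ⟧ ^ℚ p          ≡⟨ cong₂ _+_ (faulhaber p n) (cong (_^ℚ p) (⟦⟧-suc n)) ⟩
  Cp p [] ⟦ n ⟧ + (⟦ n ⟧ + 1ℚ) ^ℚ p  ≡⟨ sym (-≡⇒≡+ (ΔCp ⟦ n ⟧ p)) ⟩
  Cp p [] (⟦ n ⟧ + 1ℚ)               ≡⟨ cong (Cp p []) (sym (⟦⟧-suc n)) ⟩
  Cp p [] ⟦ suc n ⟧                  ∎

Cp₀-at-0 : ∀ p → Cp p (0 ∷ []) ⟦ 0 ⟧ ≡ 0ℚ
Cp₀-at-0 p = nested-zero p 0 _ (0 ∷ 0 ∷ []) 0 zero-^ℚ-suc

Cp₁-at-0 : ∀ p → Cp p (1 ∷ []) ⟦ 0 ⟧ ≡ 0ℚ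
Cp₁-at-0 zero    = refl
Cp₁-at-0 (suc k) = nested-zero (suc k) 1 _ (0 ∷ 1 ∷ []) 0 zero-^ℚ-suc

Cp₂-at-0 : ∀ p → Cp p (2 ∷ []) ⟦ 0 ⟧ ≡ 0ℚ
Cp₂-at-0 zero          = refl
Cp₂-at-0 (suc zero)    = refl
Cp₂-at-0 (suc (suc k)) = nested-zero (2 ℕ.+ k) 2 _ (0 ∷ 2 ∷ []) 0 zero-^ℚ-suc

Cp₀₁-at-0 : ∀ p → Cp p (0 ∷ 1 ∷ []) ⟦ 0 ⟧ ≡ 0ℚ
Cp₀₁-at-0 zero    = refl
Cp₀₁-at-0 (suc k) = nested-zero (suc k) 1 _ (0 ∷ 0 ∷ 1 ∷ []) 0 zero-^ℚ-suc

Cp₁₁-at-0 : ∀ p → Cp p (1 ∷ 1 ∷ []) ⟦ 0 ⟧ ≡ 0ℚ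
Cp₁₁-at-0 zero    = refl
Cp₁₁-at-0 (suc k) = nested-zero (suc k) 1 _ (0 ∷ 1 ∷ 1 ∷ []) 0 zero-^ℚ-suc

-- The right-hand side of the theorem with b = B_p, D = D^{(p)}(B), c = (p/2) B_{p-1},
-- T = H_n(-p), h = H_n, h₂ = H_n(2) and cₐ = C^{(p)}_a(n).
rhsForm : (b D c T h h₂ c₀ c₁ c₂ c₀₁ c₁₁ : ℚ) → ℚ
rhsForm b D c T h h₂ c₀ c₁ c₂ c₀₁ c₁₁ =
  T * h * h₂ - (b * ½) * (h * h) + (D - c₁ - c) * h - (c₀ + b * ½) * h₂ + c₀₁ + c₁₁ - c₂

rhsForm-cong : ∀ b D c T h {h₂ h₂′ c₀ c₀′ c₁ c₁′ c₂ c₂′ c₀₁ c₀₁′ c₁₁ c₁₁′ : ℚ} →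
  h₂ ≡ h₂′ → c₀ ≡ c₀′ → c₁ ≡ c₁′ → c₂ ≡ c₂′ → c₀₁ ≡ c₀₁′ → c₁₁ ≡ c₁₁′ →
  rhsForm b D c T h h₂ c₀ c₁ c₂ c₀₁ c₁₁ ≡ rhsForm b D c T h h₂′ c₀′ c₁′ c₂′ c₀₁′ c₁₁′
rhsForm-cong b D c T h refl refl refl refl refl refl = refl

rhsForm-zero : ∀ b D c → rhsForm b D c 0ℚ 0ℚ 0ℚ 0ℚ 0ℚ 0ℚ 0ℚ 0ℚ ≡ 0ℚ
rhsForm-zero = expanded
  where
  expanded : ∀ (b D c : ℚ) →
    let form = λ (T h h₂ c₀ c₁ c₂ c₀₁ c₁₁ : ℚ) →
                 T * h * h₂ - (b * ½) * (h * h) + (D - c₁ - c) * h - (c₀ + b * ½) * h₂ + c₀₁ + c₁₁ - c₂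
    in form 0ℚ 0ℚ 0ℚ 0ℚ 0ℚ 0ℚ 0ℚ 0ℚ ≡ 0ℚ
  expanded = solve-∀ ℚ-ring

-- The increments are those of the recurrences Cpₐ-step, with P = (n+1)^p and iy = 1/(n+1).
rhsForm-step : ∀ b D c T P h h₂ iy c₀ c₁ c₂ c₀₁ c₁₁ →
  let T′  = T + P
      c₀′ = c₀ + T′ * iy
      c₁′ = c₁ + (T′ * iy * iy - b * iy)
  in rhsForm b D c T′ (h + iy) (h₂ + iy * iy) c₀′ c₁′ (c₂ + (T′ * iy * iy * iy - b * iy * iy - c * iy))
                                                (c₀₁ + (c₀′ * iy * iy - D * iy)) (c₁₁ + c₁′ * iy)
     ≡ rhsForm b D c T h h₂ c₀ c₁ c₂ c₀₁ c₁₁ + P * h * h₂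
rhsForm-step = expanded
  where
  expanded : ∀ (b D c T P h h₂ iy c₀ c₁ c₂ c₀₁ c₁₁ : ℚ) →
    let form = λ (T h h₂ c₀ c₁ c₂ c₀₁ c₁₁ : ℚ) →
                 T * h * h₂ - (b * ½) * (h * h) + (D - c₁ - c) * h - (c₀ + b * ½) * h₂ + c₀₁ + c₁₁ - c₂
        T′  = T + P
        c₀′ = c₀ + T′ * iy
        c₁′ = c₁ + (T′ * iy * iy - b * iy)
    in form T′ (h + iy) (h₂ + iy * iy) c₀′ c₁′ (c₂ + (T′ * iy * iy * iy - b * iy * iy - c * iy))
            (c₀₁ + (c₀′ * iy * iy - D * iy)) (c₁₁ + c₁′ * iy)
       ≡ form T h h₂ c₀ c₁ c₂ c₀₁ c₁₁ + P * h * h₂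
  expanded = solve-∀ ℚ-ring

rhs : ℕ → ℕ → ℚ
rhs p n = rhsForm (B p) (DpB p) (⟦ p ⟧ * ½ * B (p ∸ 1)) (Hneg p n) (H n) (H2 n)
  (Cp p (0 ∷ []) ⟦ n ⟧) (Cp p (1 ∷ []) ⟦ n ⟧) (Cp p (2 ∷ []) ⟦ n ⟧)
  (Cp p (0 ∷ 1 ∷ []) ⟦ n ⟧) (Cp p (1 ∷ 1 ∷ []) ⟦ n ⟧)

harmonic-sum≡rhs : ∀ p n → Σ1 n (λ m → (⟦ m ⟧ ^ℚ p) * H (m ∸ 1) * H2 (m ∸ 1)) ≡ rhs p n
harmonic-sum≡rhs p zero    = sym (trans
  (rhsForm-cong b D c 0ℚ 0ℚ (refl {x = 0ℚ}) (Cp₀-at-0 p) (Cp₁-at-0 p) (Cp₂-at-0 p) (Cp₀₁-at-0 p) (Cp₁₁-at-0 p))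
  (rhsForm-zero b D c))
  where
  b = B p
  D = DpB p
  c = ⟦ p ⟧ * ½ * B (p ∸ 1)
harmonic-sum≡rhs p (suc n) = begin
  Σ1 n (λ m → (⟦ m ⟧ ^ℚ p) * H (m ∸ 1) * H2 (m ∸ 1)) + P * H n * H2 n
    ≡⟨ cong (_+ P * H n * H2 n) (harmonic-sum≡rhs p n) ⟩
  rhs p n + P * H n * H2 n
    ≡⟨ sym (rhsForm-step b D c T P (H n) (H2 n) iy (C₀ x) (C₁ x) (C₂ x) (C₀₁ x) (C₁₁ x)) ⟩
  rhsForm b D c (T + P) (H n + iy) (H2 n + iy * iy) (C₀ x + (T + P) * iy) C₁′ (C₂ x + (T′ * iy * iy * iy - b * iy * iy - c * iy))
    (C₀₁ x + ((C₀ x + T′ * iy) * iy * iy - D * iy)) (C₁₁ x + C₁′ * iy)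
    ≡⟨ sym (rhsForm-cong b D c (T + P) (H n + iy) (cong (λ u → H2 n + u) (inv-square n))
                         step₀ step₁ step₂ step₀₁ step₁₁) ⟩
  rhs p (suc n) ∎
  where
  b = B p
  D = DpB p
  c = ⟦ p ⟧ * ½ * B (p ∸ 1)
  x = ⟦ n ⟧
  Y = x + 1ℚ
  iy = inv (suc n)
  P = ⟦ suc n ⟧ ^ℚ p
  T = Hneg p n
  T′ = T + P
  C₀ C₁ C₂ C₀₁ C₁₁ : ℚ → ℚ
  C₀ = Cp p (0 ∷ [])
  C₁ = Cp p (1 ∷ [])
  C₂ = Cp p (2 ∷ [])
  C₀₁ = Cp p (0 ∷ 1 ∷ [])
  C₁₁ = Cp p (1 ∷ 1 ∷ [])
  C₁′ = C₁ x + (T′ * iy * iy - b * iy)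
  Y*iy≡1 : Y * iy ≡ 1ℚ
  Y*iy≡1 = trans (cong (_* iy) (sym (⟦⟧-suc n))) (inv-inverseʳ n)
  at-suc : ∀ as → Cp p as ⟦ suc n ⟧ ≡ Cp p as Y
  at-suc as = cong (Cp p as) (⟦⟧-suc n)
  Cp[Y]≡T′ : Cp p [] Y ≡ T′
  Cp[Y]≡T′ = sym (trans (faulhaber p (suc n)) (at-suc []))
  step₀ : C₀ ⟦ suc n ⟧ ≡ C₀ x + T′ * iy
  step₀ = trans (at-suc (0 ∷ [])) (trans (Cp₀-step x iy Y*iy≡1 p) (cong (λ t → C₀ x + t * iy) Cp[Y]≡T′))
  step₁ : C₁ ⟦ suc n ⟧ ≡ C₁′
  step₁ = trans (at-suc (1 ∷ [])) (trans (Cp₁-step x iy Y*iy≡1 p) (cong (λ t → C₁ x + (t * iy * iy - b * iy)) Cp[Y]≡T′))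
  step₂ : C₂ ⟦ suc n ⟧ ≡ C₂ x + (T′ * iy * iy * iy - b * iy * iy - c * iy)
  step₂ = trans (at-suc (2 ∷ []))
                (trans (Cp₂-step x iy Y*iy≡1 p) (cong (λ t → C₂ x + (t * iy * iy * iy - b * iy * iy - c * iy)) Cp[Y]≡T′))
  step₀₁ : C₀₁ ⟦ suc n ⟧ ≡ C₀₁ x + ((C₀ x + T′ * iy) * iy * iy - D * iy)
  step₀₁ = trans (at-suc (0 ∷ 1 ∷ []))
                 (trans (Cp₀₁-step x iy Y*iy≡1 p)
                        (cong (λ t → C₀₁ x + (t * iy * iy - D * iy)) (trans (sym (at-suc (0 ∷ []))) step₀)))
  step₁₁ : C₁₁ ⟦ suc n ⟧ ≡ C₁₁ x + C₁′ * iy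
  step₁₁ = trans (at-suc (1 ∷ 1 ∷ []))
                 (trans (Cp₁₁-step x iy Y*iy≡1 p) (cong (λ t → C₁₁ x + t * iy) (trans (sym (at-suc (1 ∷ []))) step₁)))

-- The identity holds for n = 0 as well.
theorem2p7 : (p n : ℕ) → 1 ≤ n →
    Σ1 n (λ m → (⟦ m ⟧ ^ℚ p) * H (m ∸ 1) * H2 (m ∸ 1))
      ≡ Hneg p n * H n * H2 n
        - (B p * ((+ 1) / 2)) * (H n * H n)
        + (DpB p - Cp p (1 ∷ []) ⟦ n ⟧ - (⟦ p ⟧ * ((+ 1) / 2)) * B (p ∸ 1)) * H n
        - (Cp p (0 ∷ []) ⟦ n ⟧ + B p * ((+ 1) / 2)) * H2 n
        + Cp p (0 ∷ 1 ∷ []) ⟦ n ⟧ + Cp p (1 ∷ 1 ∷ []) ⟦ n ⟧ - Cp p (2 ∷ []) ⟦ n ⟧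
theorem2p7 p n _ = harmonic-sum≡rhs p n
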